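{- Let $r > 3$ be an integer and set $V_3 = \{0,1,\ldots, \lfloor 2^{r^2/24}\rfloor - 1\}$. Then there is a coloring $\phi_3:\binom{V_3}{3}\to\{\beta_1,\beta_2,\beta_3\}$ of the triples of $V_3$ with 3 colors such that every subset of $V_3$ of size $r$ contains triples of at least three distinct colors. -}

module Defs where

open import Data.Nat using (ℕ; _^_; _*_; _≤_; _<_; suc)
open import Data.Fin using (Fin; toℕ)
open import Data.Fin.Subset using (Subset; _∈_)
open import Data.Product using (_×_; ∃)
open import Relation.Binary.PropositionalEquality using (_≡_)

-- N is ⌊ 2^(r²/24) ⌋ : the unique natural number with N^24 ≤ 2^(r²) < (N+1)^24.
IsFloorPow : ℕ → ℕ → Set
IsFloorPow r N = (N ^ 24 ≤ 2 ^ (r * r)) × (2 ^ (r * r) < suc N ^ 24)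

-- A coloring of the 3-element subsets {i,j,k} (i<j<k) of Fin N with 3 colors
-- (β₁, β₂, β₃ are the elements of Fin 3).
TripleColoring : ℕ → Set
TripleColoring N = (i j k : Fin N) → toℕ i < toℕ j → toℕ j < toℕ k → Fin 3

HasColour : ∀ {N} → TripleColoring N → Subset N → Fin 3 → Set
HasColour {N} φ S c =
  ∃ λ (i : Fin N) → ∃ λ (j : Fin N) → ∃ λ (k : Fin N) →
  ∃ λ (p : toℕ i < toℕ j) → ∃ λ (q : toℕ j < toℕ k) →
  (i ∈ S) × (j ∈ S) × (k ∈ S) × (φ i j k p q ≡ c)

-- Colour the M = N * (N * N) ordered triples of Fin N in all 3 ^ M ways.  For a fixed r-set S and a
-- colour c, the colourings that miss c on the t = r C 3 increasing triples of S number
-- 3 ^ (M - t) * 2 ^ t, so at most 3 * (N C r) * 3 ^ (M - t) * 2 ^ t colourings miss some colour on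
-- some r-set.  This is less than 3 ^ M once 3 * (N C r) * 2 ^ t < 3 ^ t, which follows from
-- N C r ≤ N ^ r ≤ 2 ^ (r³ / 24) and 48 + r³ ≤ 12 * (r C 3) for r ≥ 9; smaller r force N < r, when
-- there are no r-sets at all.

module Submission where

open import Defs
open import Data.Bool.Base using (Bool; true; false; T; not; _∧_; if_then_else_)
open import Data.Bool.Properties using (T-∧; T-≡; ∧-zeroʳ)
open import Data.Empty using (⊥-elim)
open import Data.Fin.Base using (Fin; zero; suc; toℕ; combine; remQuot; _↑ˡ_; _↑ʳ_)
open import Data.Fin.Properties using (_≟_; remQuot-combine; combine-remQuot)
open import Data.Fin.Subset using (Subset; ∣_∣; _∈_; inside; outside)
open import Data.Nat.Base
open import Data.Nat.Combinatorics using (_C_; nCk+nC[k+1]≡[n+1]C[k+1]; nC1≡n; k>n⇒nCk≡0)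
open import Data.Nat.Properties hiding (_≟_)
open import Data.Nat.Tactic.RingSolver using (solve-∀)
open import Data.Product.Base using (Σ; ∃; _×_; _,_; proj₁; proj₂; map₂; uncurry)
open import Data.Sum.Base using (inj₁; inj₂)
open import Data.Unit.Base using (tt)
open import Data.Vec.Base using (Vec; []; _∷_; lookup)
open import Data.Vec.Properties using (lookup⇒[]=)
open import Function.Base using (_∘_)
open import Function.Bundles using (Equivalence)
open import Relation.Binary.PropositionalEquality
open import Relation.Nullary.Decidable using (yes; no; does)
open import Relation.Nullary.Negation using (contradiction)

open import Algebra.Properties.Semiring.Sum +-*-semiring
  using (sum; sum-syntax; sum-cong-≗; sum-replicate-zero; ∑-distrib-+; *-distribˡ-sum; *-distribʳ-sum)
open import Algebra.Properties.Monoid.Sum *-1-monoid using ()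
  renaming (sum to product; sum-cong-≗ to product-cong-≗)
open Equivalence using (to; from)

𝟙 : Bool → ℕ
𝟙 true  = 1
𝟙 false = 0

𝟙*-cong : ∀ b {x y} → (T b → x ≡ y) → 𝟙 b * x ≡ 𝟙 b * y
𝟙*-cong false x≡y = refl
𝟙*-cong true  x≡y = cong (_+ 0) (x≡y tt)

𝟙*≡0⇒ : ∀ b {x} → T b → 𝟙 b * x ≡ 0 → x ≡ 0
𝟙*≡0⇒ true {x} _ eq = m+n≡0⇒m≡0 x eq

sum-const : ∀ n c → ∑[ i < n ] c ≡ n * c
sum-const zero    c = refl
sum-const (suc n) c = cong (c +_) (sum-const n c)

sum≡0⇒ : ∀ {n} (f : Fin n → ℕ) → sum f ≡ 0 → ∀ i → f i ≡ 0
sum≡0⇒ f eq zero    = m+n≡0⇒m≡0 (f zero) eq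
sum≡0⇒ f eq (suc i) = sum≡0⇒ (f ∘ suc) (m+n≡0⇒n≡0 (f zero) eq) i

sum-<⇒ : ∀ {n} (f g : Fin n → ℕ) → sum f < sum g → ∃ λ i → f i < g i
sum-<⇒ {suc n} f g lt with f zero <? g zero
... | yes f₀<g₀ = zero , f₀<g₀
... | no  f₀≮g₀ with sum-<⇒ (f ∘ suc) (g ∘ suc)
                       (+-cancelˡ-< (g zero) _ _ (≤-<-trans (+-monoˡ-≤ _ (≮⇒≥ f₀≮g₀)) lt))
...   | i , fi<gi = suc i , fi<gi

sum-↑ : ∀ m {n} (f : Fin (m + n) → ℕ) →
        sum f ≡ ∑[ i < m ] f (i ↑ˡ n) + ∑[ j < n ] f (m ↑ʳ j)
sum-↑ zero    f = refl
sum-↑ (suc m) f = trans (cong (f zero +_) (sum-↑ m (f ∘ suc))) (sym (+-assoc (f zero) _ _))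

sum-combine : ∀ m {n} (f : Fin (m * n) → ℕ) →
              sum f ≡ ∑[ i < m ] ∑[ j < n ] f (combine i j)
sum-combine zero    f = refl
sum-combine (suc m) {n} f =
  trans (sum-↑ n f) (cong (∑[ j < n ] f (j ↑ˡ (m * n)) +_) (sum-combine m (f ∘ (n ↑ʳ_))))

product≡0⇒ : ∀ {n} (f : Fin n → ℕ) → product f ≡ 0 → ∃ λ i → f i ≡ 0
product≡0⇒ {suc n} f eq with m*n≡0⇒m≡0∨n≡0 (f zero) eq
... | inj₁ f₀≡0 = zero , f₀≡0
... | inj₂ rest≡0 with product≡0⇒ (f ∘ suc) rest≡0
...   | i , fi≡0 = suc i , fi≡0

-- Sums over subsets and over colourings

∑ˢ : ∀ n → (Subset n → ℕ) → ℕ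
∑ˢ zero    f = f []
∑ˢ (suc n) f = ∑ˢ n (λ S → f (outside ∷ S)) + ∑ˢ n (λ S → f (inside ∷ S))

∑ˢ-cong : ∀ n {f g : Subset n → ℕ} → (∀ S → f S ≡ g S) → ∑ˢ n f ≡ ∑ˢ n g
∑ˢ-cong zero    f≗g = f≗g []
∑ˢ-cong (suc n) f≗g = cong₂ _+_ (∑ˢ-cong n (f≗g ∘ (outside ∷_))) (∑ˢ-cong n (f≗g ∘ (inside ∷_)))

∑ˢ-zero : ∀ n → ∑ˢ n (λ _ → 0) ≡ 0
∑ˢ-zero zero    = refl
∑ˢ-zero (suc n) = cong₂ _+_ (∑ˢ-zero n) (∑ˢ-zero n)

∑ˢ-distribʳ-* : ∀ n (f : Subset n → ℕ) a → ∑ˢ n (λ S → f S * a) ≡ ∑ˢ n f * a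
∑ˢ-distribʳ-* zero    f a = refl
∑ˢ-distribʳ-* (suc n) f a =
  trans (cong₂ _+_ (∑ˢ-distribʳ-* n (f ∘ (outside ∷_)) a) (∑ˢ-distribʳ-* n (f ∘ (inside ∷_)) a))
        (sym (*-distribʳ-+ a (∑ˢ n (f ∘ (outside ∷_))) (∑ˢ n (f ∘ (inside ∷_)))))

∑ˢ≡0⇒ : ∀ n (f : Subset n → ℕ) → ∑ˢ n f ≡ 0 → ∀ S → f S ≡ 0
∑ˢ≡0⇒ zero    f eq []            = eq
∑ˢ≡0⇒ (suc n) f eq (outside ∷ S) = ∑ˢ≡0⇒ n (f ∘ (outside ∷_)) (m+n≡0⇒m≡0 _ eq) S
∑ˢ≡0⇒ (suc n) f eq (inside ∷ S)  = ∑ˢ≡0⇒ n (f ∘ (inside ∷_)) (m+n≡0⇒n≡0 _ eq) S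

∑ˢ[∣S∣≡r]≡nCr : ∀ n r → ∑ˢ n (λ S → 𝟙 (∣ S ∣ ≡ᵇ r)) ≡ n C r
∑ˢ[∣S∣≡r]≡nCr zero    zero    = refl
∑ˢ[∣S∣≡r]≡nCr zero    (suc r) = refl
∑ˢ[∣S∣≡r]≡nCr (suc n) zero    = cong₂ _+_ (∑ˢ[∣S∣≡r]≡nCr n zero) (∑ˢ-zero n)
∑ˢ[∣S∣≡r]≡nCr (suc n) (suc r) = begin
  ∑ˢ n (λ S → 𝟙 (∣ S ∣ ≡ᵇ suc r)) + ∑ˢ n (λ S → 𝟙 (∣ S ∣ ≡ᵇ r))
    ≡⟨ cong₂ _+_ (∑ˢ[∣S∣≡r]≡nCr n (suc r)) (∑ˢ[∣S∣≡r]≡nCr n r) ⟩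
  n C suc r + n C r  ≡⟨ +-comm (n C suc r) (n C r) ⟩
  n C r + n C suc r  ≡⟨ nCk+nC[k+1]≡[n+1]C[k+1] n r ⟩
  suc n C suc r      ∎
  where open ≡-Reasoning

nCk≤n^k : ∀ n k → n C k ≤ n ^ k
nCk≤n^k zero    zero    = ≤-refl
nCk≤n^k zero    (suc k) = z≤n
nCk≤n^k (suc n) zero    = ≤-refl
nCk≤n^k (suc n) (suc k) = begin
  suc n C suc k             ≡⟨ nCk+nC[k+1]≡[n+1]C[k+1] n k ⟨
  n C k + n C suc k         ≤⟨ +-mono-≤ (nCk≤n^k n k) (nCk≤n^k n (suc k)) ⟩
  n ^ k + n * n ^ k         ≤⟨ +-mono-≤ nᵏ≤[1+n]ᵏ (*-monoʳ-≤ n nᵏ≤[1+n]ᵏ) ⟩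
  suc n ^ k + n * suc n ^ k ∎
  where
  open ≤-Reasoning
  nᵏ≤[1+n]ᵏ : n ^ k ≤ suc n ^ k
  nᵏ≤[1+n]ᵏ = ^-monoˡ-≤ k (n≤1+n n)

∑ᶜ : ∀ {k} M → (Vec (Fin k) M → ℕ) → ℕ
∑ᶜ         zero    f = f []
∑ᶜ {k = k} (suc M) f = ∑[ x < k ] ∑ᶜ M (λ v → f (x ∷ v))

module _ {k : ℕ} where

  ∑ᶜ-distrib-+ : ∀ M (f g : Vec (Fin k) M → ℕ) → ∑ᶜ M (λ v → f v + g v) ≡ ∑ᶜ M f + ∑ᶜ M g
  ∑ᶜ-distrib-+ zero    f g = refl
  ∑ᶜ-distrib-+ (suc M) f g =
    trans (sum-cong-≗ (λ x → ∑ᶜ-distrib-+ M (f ∘ (x ∷_)) (g ∘ (x ∷_))))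
          (∑-distrib-+ (λ x → ∑ᶜ M (f ∘ (x ∷_))) (λ x → ∑ᶜ M (g ∘ (x ∷_))))

  ∑ᶜ-distribˡ-* : ∀ M a (f : Vec (Fin k) M → ℕ) → ∑ᶜ M (λ v → a * f v) ≡ a * ∑ᶜ M f
  ∑ᶜ-distribˡ-* zero    a f = refl
  ∑ᶜ-distribˡ-* (suc M) a f =
    trans (sum-cong-≗ (λ x → ∑ᶜ-distribˡ-* M a (f ∘ (x ∷_))))
          (sym (*-distribˡ-sum a (λ x → ∑ᶜ M (f ∘ (x ∷_)))))

  ∑ᶜ-∑-comm : ∀ M {m} (f : Fin m → Vec (Fin k) M → ℕ) →
              ∑ᶜ M (λ v → ∑[ c < m ] f c v) ≡ ∑[ c < m ] ∑ᶜ M (f c)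
  ∑ᶜ-∑-comm M {zero}  f = ∑ᶜ-zero M
    where
    ∑ᶜ-zero : ∀ M → ∑ᶜ {k} M (λ _ → 0) ≡ 0
    ∑ᶜ-zero zero    = refl
    ∑ᶜ-zero (suc M) =
      trans (sum-cong-≗ {k} {λ _ → ∑ᶜ {k} M (λ _ → 0)} (λ _ → ∑ᶜ-zero M)) (sum-replicate-zero k)
  ∑ᶜ-∑-comm M {suc m} f =
    trans (∑ᶜ-distrib-+ M (f zero) _) (cong (∑ᶜ M (f zero) +_) (∑ᶜ-∑-comm M (f ∘ suc)))

  ∑ᶜ-∑ˢ-comm : ∀ M n (f : Subset n → Vec (Fin k) M → ℕ) →
               ∑ᶜ M (λ v → ∑ˢ n (λ S → f S v)) ≡ ∑ˢ n (λ S → ∑ᶜ M (f S))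
  ∑ᶜ-∑ˢ-comm M zero    f = refl
  ∑ᶜ-∑ˢ-comm M (suc n) f =
    trans (∑ᶜ-distrib-+ M _ _)
          (cong₂ _+_ (∑ᶜ-∑ˢ-comm M n (f ∘ (outside ∷_))) (∑ᶜ-∑ˢ-comm M n (f ∘ (inside ∷_))))

  ∑ᶜ-1 : ∀ M → ∑ᶜ {k} M (λ _ → 1) ≡ k ^ M
  ∑ᶜ-1 zero    = refl
  ∑ᶜ-1 (suc M) =
    trans (sum-cong-≗ {k} {λ _ → ∑ᶜ {k} M (λ _ → 1)} (λ _ → ∑ᶜ-1 M)) (sum-const k (k ^ M))

  ∑ᶜ-product : ∀ M (F : Fin M → Fin k → ℕ) →
               ∑ᶜ M (λ v → product (λ p → F p (lookup v p))) ≡ product (λ p → ∑[ x < k ] F p x)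
  ∑ᶜ-product zero    F = refl
  ∑ᶜ-product (suc M) F = begin
    ∑[ x < k ] ∑ᶜ M (λ v → F zero x * rest v)
      ≡⟨ sum-cong-≗ (λ x → ∑ᶜ-distribˡ-* M (F zero x) rest) ⟩
    ∑[ x < k ] (F zero x * ∑ᶜ M rest)
      ≡⟨ sum-cong-≗ (λ x → cong (F zero x *_) (∑ᶜ-product M (F ∘ suc))) ⟩
    ∑[ x < k ] (F zero x * product′)
      ≡⟨ *-distribʳ-sum product′ (F zero) ⟨
    ∑[ x < k ] F zero x * product′
      ∎
    where
    open ≡-Reasoning
    rest : Vec (Fin k) M → ℕ
    rest v = product (λ p → F (suc p) (lookup v p))
    product′ : ℕ
    product′ = product (λ p → ∑[ x < k ] F (suc p) x)

  ∑ᶜ-<⇒ : ∀ M (f g : Vec (Fin k) M → ℕ) → ∑ᶜ M f < ∑ᶜ M g → ∃ λ v → f v < g v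
  ∑ᶜ-<⇒ zero    f g lt = [] , lt
  ∑ᶜ-<⇒ (suc M) f g lt with sum-<⇒ (λ x → ∑ᶜ M (f ∘ (x ∷_))) (λ x → ∑ᶜ M (g ∘ (x ∷_))) lt
  ... | x , ltₓ with ∑ᶜ-<⇒ M (f ∘ (x ∷_)) (g ∘ (x ∷_)) ltₓ
  ...   | v , ltᵥ = x ∷ v , ltᵥ

-- The union bound

avoids : ∀ {k M} → Fin k → (Fin M → Bool) → Vec (Fin k) M → ℕ
avoids c P v = product (λ p → 𝟙 (not (P p ∧ does (lookup v p ≟ c))))

∑-𝟙-≢ : ∀ {k} (c : Fin (suc k)) → ∑[ x < suc k ] 𝟙 (not (does (x ≟ c))) ≡ k
∑-𝟙-≢ {k}     zero    = trans (sum-const k 1) (*-identityʳ k)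
∑-𝟙-≢ {suc k} (suc c) = cong suc (∑-𝟙-≢ c)

∑-𝟙-avoid : ∀ {k} b (c : Fin (suc k)) →
            ∑[ x < suc k ] 𝟙 (not (b ∧ does (x ≟ c))) ≡ (if b then k else suc k)
∑-𝟙-avoid {k} false c = trans (sum-const (suc k) 1) (*-identityʳ (suc k))
∑-𝟙-avoid     true  c = ∑-𝟙-≢ c

product-if : ∀ {M} (P : Fin M → Bool) a b →
             product (λ p → if P p then a else b) * b ^ ∑[ p < M ] 𝟙 (P p)
             ≡ b ^ M * a ^ ∑[ p < M ] 𝟙 (P p)
product-if {zero}  P a b = refl
product-if {suc M} P a b with P zero | product-if (P ∘ suc) a b
... | true  | ih = begin
  a * Q * (b * B)   ≡⟨ swap-middle a Q b B ⟩
  a * b * (Q * B)   ≡⟨ cong (a * b *_) ih ⟩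
  a * b * (bᴹ * A)  ≡⟨ cong (_* (bᴹ * A)) (*-comm a b) ⟩
  b * a * (bᴹ * A)  ≡⟨ swap-middle b bᴹ a A ⟨
  b * bᴹ * (a * A)  ∎
  where
  open ≡-Reasoning
  Q B A bᴹ : ℕ
  Q = product (λ p → if P (suc p) then a else b)
  B = b ^ ∑[ p < M ] 𝟙 (P (suc p))
  A = a ^ ∑[ p < M ] 𝟙 (P (suc p))
  bᴹ = b ^ M
  swap-middle : ∀ w x y z → w * x * (y * z) ≡ w * y * (x * z)
  swap-middle = solve-∀
... | false | ih = trans (*-assoc b _ _) (trans (cong (b *_) ih) (sym (*-assoc b _ _)))

-- This is (k + 1) ^ (M - t) * k ^ t, multiplied through by (k + 1) ^ t to avoid truncated subtraction.
∑ᶜ-avoids : ∀ {k} M (c : Fin (suc k)) (P : Fin M → Bool) →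
            ∑ᶜ M (avoids c P) * suc k ^ ∑[ p < M ] 𝟙 (P p) ≡ suc k ^ M * k ^ ∑[ p < M ] 𝟙 (P p)
∑ᶜ-avoids {k} M c P = begin
  ∑ᶜ M (avoids c P) * suc k ^ t
    ≡⟨ cong (_* suc k ^ t) (∑ᶜ-product M (λ p x → 𝟙 (not (P p ∧ does (x ≟ c))))) ⟩
  product (λ p → ∑[ x < suc k ] 𝟙 (not (P p ∧ does (x ≟ c)))) * suc k ^ t
    ≡⟨ cong (_* suc k ^ t) (product-cong-≗ (λ p → ∑-𝟙-avoid (P p) c)) ⟩
  product (λ p → if P p then k else suc k) * suc k ^ t
    ≡⟨ product-if P k (suc k) ⟩
  suc k ^ M * k ^ t ∎
  where
  open ≡-Reasoning
  t : ℕ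
  t = ∑[ p < M ] 𝟙 (P p)

avoids≡0⇒ : ∀ {k M} (c : Fin k) (P : Fin M → Bool) v →
            avoids c P v ≡ 0 → ∃ λ p → T (P p) × lookup v p ≡ c
avoids≡0⇒ c P v eq with product≡0⇒ (λ p → 𝟙 (not (P p ∧ does (lookup v p ≟ c)))) eq
... | p , eqₚ with P p in Pp≡true | lookup v p ≟ c
...   | true  | yes vp≡c = p , from T-≡ Pp≡true , vp≡c
...   | true  | no  _    with () ← eqₚ
...   | false | _        with () ← eqₚ

module _ {k M n : ℕ} (chosen : Subset n → Bool) (P : Subset n → Fin M → Bool) (t : ℕ)
         (∣P∣≡t : ∀ S → T (chosen S) → ∑[ p < M ] 𝟙 (P S p) ≡ t) where

  missed : Vec (Fin (suc k)) M → ℕ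
  missed v = ∑ˢ n (λ S → 𝟙 (chosen S) * ∑[ c < suc k ] avoids c (P S) v)

  ∑ᶜ-missed : ∑ᶜ M missed * suc k ^ t ≡ ∑ˢ n (𝟙 ∘ chosen) * (suc k * (suc k ^ M * k ^ t))
  ∑ᶜ-missed = begin
    ∑ᶜ M missed * suc k ^ t
      ≡⟨ cong (_* suc k ^ t) (∑ᶜ-∑ˢ-comm M n (λ S v → 𝟙 (chosen S) * missedBy S v)) ⟩
    ∑ˢ n (λ S → ∑ᶜ M (λ v → 𝟙 (chosen S) * missedBy S v)) * suc k ^ t
      ≡⟨ ∑ˢ-distribʳ-* n (λ S → ∑ᶜ M (λ v → 𝟙 (chosen S) * missedBy S v)) (suc k ^ t) ⟨
    ∑ˢ n (λ S → ∑ᶜ M (λ v → 𝟙 (chosen S) * missedBy S v) * suc k ^ t)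
      ≡⟨ ∑ˢ-cong n per-set ⟩
    ∑ˢ n (λ S → 𝟙 (chosen S) * (suc k * (suc k ^ M * k ^ t)))
      ≡⟨ ∑ˢ-distribʳ-* n (𝟙 ∘ chosen) (suc k * (suc k ^ M * k ^ t)) ⟩
    ∑ˢ n (𝟙 ∘ chosen) * (suc k * (suc k ^ M * k ^ t)) ∎
    where
    open ≡-Reasoning
    missedBy : Subset n → Vec (Fin (suc k)) M → ℕ
    missedBy S v = ∑[ c < suc k ] avoids c (P S) v

    ∑ᶜ-missedBy : ∀ S → T (chosen S) → ∑ᶜ M (missedBy S) * suc k ^ t ≡ suc k * (suc k ^ M * k ^ t)
    ∑ᶜ-missedBy S chosenS = begin
      ∑ᶜ M (missedBy S) * suc k ^ t
        ≡⟨ cong (_* suc k ^ t) (∑ᶜ-∑-comm M (λ c → avoids c (P S))) ⟩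
      ∑[ c < suc k ] ∑ᶜ M (avoids c (P S)) * suc k ^ t
        ≡⟨ *-distribʳ-sum (suc k ^ t) (λ c → ∑ᶜ M (avoids c (P S))) ⟩
      ∑[ c < suc k ] (∑ᶜ M (avoids c (P S)) * suc k ^ t)
        ≡⟨ sum-cong-≗ (λ c → subst (λ s → ∑ᶜ M (avoids c (P S)) * suc k ^ s ≡ suc k ^ M * k ^ s)
                                    (∣P∣≡t S chosenS) (∑ᶜ-avoids M c (P S))) ⟩
      ∑[ c < suc k ] (suc k ^ M * k ^ t)
        ≡⟨ sum-const (suc k) (suc k ^ M * k ^ t) ⟩
      suc k * (suc k ^ M * k ^ t) ∎

    per-set : ∀ S → ∑ᶜ M (λ v → 𝟙 (chosen S) * missedBy S v) * suc k ^ t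
                    ≡ 𝟙 (chosen S) * (suc k * (suc k ^ M * k ^ t))
    per-set S = begin
      ∑ᶜ M (λ v → 𝟙 (chosen S) * missedBy S v) * suc k ^ t
        ≡⟨ cong (_* suc k ^ t) (∑ᶜ-distribˡ-* M (𝟙 (chosen S)) (missedBy S)) ⟩
      𝟙 (chosen S) * ∑ᶜ M (missedBy S) * suc k ^ t
        ≡⟨ *-assoc (𝟙 (chosen S)) _ _ ⟩
      𝟙 (chosen S) * (∑ᶜ M (missedBy S) * suc k ^ t)
        ≡⟨ 𝟙*-cong (chosen S) (∑ᶜ-missedBy S) ⟩
      𝟙 (chosen S) * (suc k * (suc k ^ M * k ^ t)) ∎

  ∃-hitting-colouring : suc k * ∑ˢ n (𝟙 ∘ chosen) * k ^ t < suc k ^ t →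
    ∃ λ (v : Vec (Fin (suc k)) M) →
      ∀ S → T (chosen S) → ∀ c → ∃ λ p → T (P S p) × lookup v p ≡ c
  ∃-hitting-colouring bound with ∑ᶜ-<⇒ M missed (λ _ → 1) few-missed
    where
    few-missed : ∑ᶜ M missed < ∑ᶜ M (λ _ → 1)
    few-missed = *-cancelʳ-< (suc k ^ t) _ _ (begin-strict
      ∑ᶜ M missed * suc k ^ t
        ≡⟨ ∑ᶜ-missed ⟩
      ∑ˢ n (𝟙 ∘ chosen) * (suc k * (suc k ^ M * k ^ t))
        ≡⟨ rearrange (∑ˢ n (𝟙 ∘ chosen)) (suc k) (suc k ^ M) (k ^ t) ⟩
      suc k ^ M * (suc k * ∑ˢ n (𝟙 ∘ chosen) * k ^ t)
        <⟨ *-monoʳ-< (suc k ^ M) {{m^n≢0 (suc k) M}} bound ⟩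
      suc k ^ M * suc k ^ t
        ≡⟨ cong (_* suc k ^ t) (∑ᶜ-1 M) ⟨
      ∑ᶜ M (λ _ → 1) * suc k ^ t
        ∎)
      where
      open ≤-Reasoning
      rearrange : ∀ a b x y → a * (b * (x * y)) ≡ x * (b * a * y)
      rearrange = solve-∀
  ... | v , missed<1 = v , hits
    where
    hits : ∀ S → T (chosen S) → ∀ c → ∃ λ p → T (P S p) × lookup v p ≡ c
    hits S chosenS c = avoids≡0⇒ c (P S) v (sum≡0⇒ (λ c → avoids c (P S) v) none-missed c)
      where
      none-missed : ∑[ c < suc k ] avoids c (P S) v ≡ 0
      none-missed = 𝟙*≡0⇒ (chosen S) chosenS
        (∑ˢ≡0⇒ n (λ S → 𝟙 (chosen S) * ∑[ c < suc k ] avoids c (P S) v) (n<1⇒n≡0 missed<1) S)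

-- Increasing triples in a subset

isPair? : ∀ {n} → Subset n → Fin n → Fin n → Bool
isPair? S j k = (toℕ j <ᵇ toℕ k) ∧ (lookup S j ∧ lookup S k)

isTriple? : ∀ {n} → Subset n → Fin n × Fin n × Fin n → Bool
isTriple? S (i , j , k) = (toℕ i <ᵇ toℕ j) ∧ (lookup S i ∧ isPair? S j k)

countPairs : ∀ {n} → Subset n → ℕ
countPairs {n} S = ∑[ j < n ] ∑[ k < n ] 𝟙 (isPair? S j k)

countTriples : ∀ {n} → Subset n → ℕ
countTriples {n} S = ∑[ i < n ] ∑[ j < n ] ∑[ k < n ] 𝟙 (isTriple? S (i , j , k))

∑-𝟙-lookup : ∀ {n} (S : Subset n) → ∑[ k < n ] 𝟙 (lookup S k) ≡ ∣ S ∣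
∑-𝟙-lookup []            = refl
∑-𝟙-lookup (outside ∷ S) = ∑-𝟙-lookup S
∑-𝟙-lookup (inside ∷ S)  = cong suc (∑-𝟙-lookup S)

countPairs≡∣S∣C2 : ∀ {n} (S : Subset n) → countPairs S ≡ ∣ S ∣ C 2
countPairs≡∣S∣C2         []            = refl
countPairs≡∣S∣C2 {suc n} (outside ∷ S) = cong₂ _+_ (sum-replicate-zero n) (countPairs≡∣S∣C2 S)
countPairs≡∣S∣C2         (inside ∷ S)  = begin
  ∑[ k < _ ] 𝟙 (lookup S k) + countPairs S
    ≡⟨ cong₂ _+_ (trans (∑-𝟙-lookup S) (sym (nC1≡n ∣ S ∣))) (countPairs≡∣S∣C2 S) ⟩
  ∣ S ∣ C 1 + ∣ S ∣ C 2
    ≡⟨ nCk+nC[k+1]≡[n+1]C[k+1] ∣ S ∣ 1 ⟩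
  suc ∣ S ∣ C 2
    ∎
  where open ≡-Reasoning

countTriples-later-rows : ∀ {n} x (S : Subset n) →
  ∑[ i < n ] ∑[ j < suc n ] ∑[ k < suc n ] 𝟙 (isTriple? (x ∷ S) (suc i , j , k)) ≡ countTriples S
countTriples-later-rows {n} x S =
  sum-cong-≗ λ i → cong₂ _+_ (sum-replicate-zero (suc n))
                              (sum-cong-≗ λ j → cong (λ b → 𝟙 b + ∑[ k < n ] 𝟙 (isTriple? S (i , j , k)))
                                 (trans (cong ((toℕ i <ᵇ toℕ j) ∧_) (∧-zeroʳ (lookup S i))) (∧-zeroʳ _)))

countTriples≡∣S∣C3 : ∀ {n} (S : Subset n) → countTriples S ≡ ∣ S ∣ C 3
countTriples≡∣S∣C3         []            = refl
countTriples≡∣S∣C3 {suc n} (outside ∷ S) = begin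
  countTriples (outside ∷ S) ≡⟨ cong₂ _+_ first-row (countTriples-later-rows outside S) ⟩
  countTriples S             ≡⟨ countTriples≡∣S∣C3 S ⟩
  ∣ S ∣ C 3                  ∎
  where
  open ≡-Reasoning
  first-row : ∑[ j < suc n ] ∑[ k < suc n ] 𝟙 (isTriple? (outside ∷ S) (zero , j , k)) ≡ 0
  first-row = cong₂ _+_ (sum-replicate-zero (suc n))
                        (trans (sum-cong-≗ {n} {λ _ → ∑[ k < suc n ] 0} (λ _ → sum-replicate-zero (suc n)))
                               (sum-replicate-zero n))
countTriples≡∣S∣C3 {suc n} (inside ∷ S) = begin
  countTriples (inside ∷ S) ≡⟨ cong₂ _+_ first-row (countTriples-later-rows inside S) ⟩
  countPairs S + countTriples S ≡⟨ cong₂ _+_ (countPairs≡∣S∣C2 S) (countTriples≡∣S∣C3 S) ⟩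
  ∣ S ∣ C 2 + ∣ S ∣ C 3       ≡⟨ nCk+nC[k+1]≡[n+1]C[k+1] ∣ S ∣ 2 ⟩
  suc ∣ S ∣ C 3               ∎
  where
  open ≡-Reasoning
  first-row : ∑[ j < suc n ] ∑[ k < suc n ] 𝟙 (isTriple? (inside ∷ S) (zero , j , k)) ≡ countPairs S
  first-row = cong (_+ countPairs S) (sum-replicate-zero (suc n))

isTriple?-sound : ∀ {n} (S : Subset n) i j k → T (isTriple? S (i , j , k)) →
                  toℕ i < toℕ j × toℕ j < toℕ k × i ∈ S × j ∈ S × k ∈ S
isTriple?-sound S i j k triple =
  let i<j , Sᵢ∧pair = to T-∧ triple
      Sᵢ , pair     = to T-∧ Sᵢ∧pair
      j<k , Sⱼ∧Sₖ   = to T-∧ pair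
      Sⱼ , Sₖ       = to T-∧ Sⱼ∧Sₖ
  in <ᵇ⇒< (toℕ i) (toℕ j) i<j , <ᵇ⇒< (toℕ j) (toℕ k) j<k ,
     T-lookup⇒∈ i Sᵢ , T-lookup⇒∈ j Sⱼ , T-lookup⇒∈ k Sₖ
  where
  T-lookup⇒∈ : ∀ i → T (lookup S i) → i ∈ S
  T-lookup⇒∈ i Sᵢ = lookup⇒[]= i S (to T-≡ Sᵢ)

-- A colouring of Fin (n * (n * n)) colours every ordered triple; only the increasing ones are read.
encode₃ : ∀ {n} → Fin n × Fin n × Fin n → Fin (n * (n * n))
encode₃ (i , j , k) = combine i (combine j k)

decode₃ : ∀ {n} → Fin (n * (n * n)) → Fin n × Fin n × Fin n
decode₃ {n} = map₂ (remQuot {n} n) ∘ remQuot {n} (n * n)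

decode₃-encode₃ : ∀ {n} (i j k : Fin n) → decode₃ (encode₃ (i , j , k)) ≡ (i , j , k)
decode₃-encode₃ {n} i j k =
  trans (cong (map₂ (remQuot n)) (remQuot-combine i (combine j k)))
        (cong (i ,_) (remQuot-combine j k))

encode₃-decode₃ : ∀ {n} (p : Fin (n * (n * n))) → encode₃ {n} (decode₃ p) ≡ p
encode₃-decode₃ {n} p =
  trans (cong (combine {n} i) (combine-remQuot {n} n q)) (combine-remQuot {n} (n * n) p)
  where
  i : Fin n
  i = proj₁ (remQuot {n} (n * n) p)
  q : Fin (n * n)
  q = proj₂ (remQuot {n} (n * n) p)

sum-decode₃ : ∀ {n} (f : Fin n × Fin n × Fin n → ℕ) →
              ∑[ p < n * (n * n) ] f (decode₃ p) ≡ ∑[ i < n ] ∑[ j < n ] ∑[ k < n ] f (i , j , k)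
sum-decode₃ {n} f =
  trans (sum-combine n (f ∘ decode₃)) (sum-cong-≗ λ i →
    trans (sum-combine n (f ∘ decode₃ ∘ combine i)) (sum-cong-≗ λ j → sum-cong-≗ λ k →
      cong f (decode₃-encode₃ i j k)))

2*[1+nC2]≡[1+n]*n : ∀ n → 2 * (suc n C 2) ≡ suc n * n
2*[1+nC2]≡[1+n]*n zero    = refl
2*[1+nC2]≡[1+n]*n (suc n) = begin
  2 * (suc (suc n) C 2)
    ≡⟨ cong (2 *_) (nCk+nC[k+1]≡[n+1]C[k+1] (suc n) 1) ⟨
  2 * (suc n C 1 + suc n C 2)
    ≡⟨ *-distribˡ-+ 2 (suc n C 1) (suc n C 2) ⟩
  2 * (suc n C 1) + 2 * (suc n C 2)
    ≡⟨ cong₂ _+_ (cong (2 *_) (nC1≡n (suc n))) (2*[1+nC2]≡[1+n]*n n) ⟩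
  2 * suc n + suc n * n
    ≡⟨ expand n ⟩
  suc (suc n) * suc n
    ∎
  where
  open ≡-Reasoning
  expand : ∀ n → 2 * suc n + suc n * n ≡ suc (suc n) * suc n
  expand = solve-∀

6*[2+nC3]≡[2+n]*[1+n]*n : ∀ n → 6 * (suc (suc n) C 3) ≡ suc (suc n) * suc n * n
6*[2+nC3]≡[2+n]*[1+n]*n zero    = refl
6*[2+nC3]≡[2+n]*[1+n]*n (suc n) = begin
  6 * (3+n C 3)
    ≡⟨ cong (6 *_) (nCk+nC[k+1]≡[n+1]C[k+1] 2+n 2) ⟨
  6 * (2+n C 2 + 2+n C 3)
    ≡⟨ *-distribˡ-+ 6 (2+n C 2) (2+n C 3) ⟩
  6 * (2+n C 2) + 6 * (2+n C 3)
    ≡⟨ cong (_+ 6 * (2+n C 3)) (*-assoc 3 2 (2+n C 2)) ⟩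
  3 * (2 * (2+n C 2)) + 6 * (2+n C 3)
    ≡⟨ cong₂ _+_ (cong (3 *_) (2*[1+nC2]≡[1+n]*n (suc n))) (6*[2+nC3]≡[2+n]*[1+n]*n n) ⟩
  3 * (2+n * suc n) + 2+n * suc n * n
    ≡⟨ expand n ⟩
  3+n * 2+n * suc n
    ∎
  where
  open ≡-Reasoning
  2+n 3+n : ℕ
  2+n = suc (suc n)
  3+n = suc 2+n
  expand : ∀ n → 3 * (suc (suc n) * suc n) + suc (suc n) * suc n * n
                 ≡ suc (suc (suc n)) * suc (suc n) * suc n
  expand = solve-∀

48+r³≤12*rC3 : ∀ r → 9 ≤ r → 48 + r * r * r ≤ 12 * (r C 3)
48+r³≤12*rC3 r 9≤r with m≤n⇒∃[o]m+o≡n 9≤r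
... | k , refl = begin
  48 + (9 + k) * (9 + k) * (9 + k)
    ≤⟨ m≤m+n _ (k * k * k + 21 * k * k + 139 * k + 231) ⟩
  48 + (9 + k) * (9 + k) * (9 + k) + (k * k * k + 21 * k * k + 139 * k + 231)
    ≡⟨ expand k ⟩
  2 * ((9 + k) * (8 + k) * (7 + k))
    ≡⟨ cong (2 *_) (6*[2+nC3]≡[2+n]*[1+n]*n (7 + k)) ⟨
  2 * (6 * ((9 + k) C 3))
    ≡⟨ *-assoc 2 6 ((9 + k) C 3) ⟨
  12 * ((9 + k) C 3)
    ∎
  where
  open ≤-Reasoning
  expand : ∀ k → 48 + (9 + k) * (9 + k) * (9 + k) + (k * k * k + 21 * k * k + 139 * k + 231)
                 ≡ 2 * ((9 + k) * (8 + k) * (7 + k))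
  expand = solve-∀

^-distrib-* : ∀ m n o → (m * n) ^ o ≡ m ^ o * n ^ o
^-distrib-* m n zero    = refl
^-distrib-* m n (suc o) =
  trans (cong (m * n *_) (^-distrib-* m n o)) (swap-middle m n (m ^ o) (n ^ o))
  where
  swap-middle : ∀ w x y z → w * x * (y * z) ≡ w * y * (x * z)
  swap-middle = solve-∀

^-cancelʳ-< : ∀ n {a b} → a ^ n < b ^ n → a < b
^-cancelʳ-< n {a} {b} aⁿ<bⁿ with a <? b
... | yes a<b = a<b
... | no  a≮b = contradiction (^-monoˡ-≤ n (≮⇒≥ a≮b)) (<⇒≱ aⁿ<bⁿ)

3*x*2ᵗ<3ᵗ : ∀ x R t → x ^ 24 ≤ 2 ^ R → 48 + R ≤ 12 * t → 3 * x * 2 ^ t < 3 ^ t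
3*x*2ᵗ<3ᵗ x R t x²⁴≤2ᴿ 48+R≤12t = ^-cancelʳ-< 24 (begin-strict
  (3 * x * 2 ^ t) ^ 24              ≤⟨ ^-monoˡ-≤ 24 (*-monoˡ-≤ (2 ^ t) (*-monoˡ-≤ x (n≤1+n 3))) ⟩
  (4 * x * 2 ^ t) ^ 24              ≡⟨ cong (_^ 24) (regroup x (2 ^ t)) ⟩
  (x * 2 ^ (2 + t)) ^ 24            ≡⟨ ^-distrib-* x (2 ^ (2 + t)) 24 ⟩
  x ^ 24 * (2 ^ (2 + t)) ^ 24       ≤⟨ *-monoˡ-≤ ((2 ^ (2 + t)) ^ 24) x²⁴≤2ᴿ ⟩
  2 ^ R * (2 ^ (2 + t)) ^ 24        ≡⟨ cong (2 ^ R *_) (^-*-assoc 2 (2 + t) 24) ⟩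
  2 ^ R * 2 ^ ((2 + t) * 24)        ≡⟨ ^-distribˡ-+-* 2 R ((2 + t) * 24) ⟨
  2 ^ (R + (2 + t) * 24)            ≤⟨ ^-monoʳ-≤ 2 exponent-bound ⟩
  2 ^ (3 * (12 * t))                ≡⟨ ^-*-assoc 2 3 (12 * t) ⟨
  8 ^ (12 * t)                      <⟨ ^-monoˡ-< (12 * t) {{12t≢0}} ≤-refl ⟩
  9 ^ (12 * t)                      ≡⟨ ^-*-assoc 3 2 (12 * t) ⟩
  3 ^ (2 * (12 * t))                ≡⟨ cong (3 ^_) (*-comm-24 t) ⟩
  3 ^ (t * 24)                      ≡⟨ ^-*-assoc 3 t 24 ⟨
  (3 ^ t) ^ 24                      ∎)
  where
  open ≤-Reasoning
  regroup : ∀ a b → 4 * a * b ≡ a * (2 * (2 * b))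
  regroup = solve-∀
  *-comm-24 : ∀ t → 2 * (12 * t) ≡ t * 24
  *-comm-24 = solve-∀
  exponent-bound : R + (2 + t) * 24 ≤ 3 * (12 * t)
  exponent-bound = begin
    R + (2 + t) * 24      ≡⟨ shuffle R t ⟩
    (48 + R) + 24 * t     ≤⟨ +-monoˡ-≤ (24 * t) 48+R≤12t ⟩
    12 * t + 24 * t       ≡⟨ collect t ⟩
    3 * (12 * t)          ∎
    where
    shuffle : ∀ R t → R + (2 + t) * 24 ≡ (48 + R) + 24 * t
    shuffle = solve-∀
    collect : ∀ t → 12 * t + 24 * t ≡ 3 * (12 * t)
    collect = solve-∀
  12t≢0 : NonZero (12 * t)
  12t≢0 = >-nonZero (<-≤-trans (s≤s z≤n) (≤-trans (m≤m+n 48 R) 48+R≤12t))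

r^24≤2^r²⇒9≤r : ∀ r → 3 < r → r ^ 24 ≤ 2 ^ (r * r) → 9 ≤ r
r^24≤2^r²⇒9≤r 1 (s≤s ())
r^24≤2^r²⇒9≤r 2 (s≤s (s≤s ()))
r^24≤2^r²⇒9≤r 3 (s≤s (s≤s (s≤s ())))
r^24≤2^r²⇒9≤r 4 _ r²⁴≤ = ⊥-elim (≤⇒≤ᵇ r²⁴≤)
r^24≤2^r²⇒9≤r 5 _ r²⁴≤ = ⊥-elim (≤⇒≤ᵇ r²⁴≤)
r^24≤2^r²⇒9≤r 6 _ r²⁴≤ = ⊥-elim (≤⇒≤ᵇ r²⁴≤)
r^24≤2^r²⇒9≤r 7 _ r²⁴≤ = ⊥-elim (≤⇒≤ᵇ r²⁴≤)
r^24≤2^r²⇒9≤r 8 _ r²⁴≤ = ⊥-elim (≤⇒≤ᵇ r²⁴≤)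
r^24≤2^r²⇒9≤r (suc (suc (suc (suc (suc (suc (suc (suc (suc k))))))))) _ _ = m≤m+n 9 k

3*[NCr]*2^[rC3]<3^[rC3] : ∀ r N → 3 < r → N ^ 24 ≤ 2 ^ (r * r) →
                          3 * (N C r) * 2 ^ (r C 3) < 3 ^ (r C 3)
3*[NCr]*2^[rC3]<3^[rC3] r N 3<r N²⁴≤2^r² with N <? r
... | yes N<r rewrite k>n⇒nCk≡0 N<r = m^n>0 3 (r C 3)
... | no  N≮r = 3*x*2ᵗ<3ᵗ (N C r) (r * r * r) (r C 3) [NCr]²⁴≤2^r³
                  (48+r³≤12*rC3 r (r^24≤2^r²⇒9≤r r 3<r (≤-trans (^-monoˡ-≤ 24 (≮⇒≥ N≮r)) N²⁴≤2^r²)))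
  where
  [NCr]²⁴≤2^r³ : (N C r) ^ 24 ≤ 2 ^ (r * r * r)
  [NCr]²⁴≤2^r³ = begin
    (N C r) ^ 24    ≤⟨ ^-monoˡ-≤ 24 (nCk≤n^k N r) ⟩
    (N ^ r) ^ 24    ≡⟨ ^-*-assoc N r 24 ⟩
    N ^ (r * 24)    ≡⟨ cong (N ^_) (*-comm r 24) ⟩
    N ^ (24 * r)    ≡⟨ ^-*-assoc N 24 r ⟨
    (N ^ 24) ^ r    ≤⟨ ^-monoˡ-≤ r N²⁴≤2^r² ⟩
    (2 ^ (r * r)) ^ r ≡⟨ ^-*-assoc 2 (r * r) r ⟩
    2 ^ (r * r * r) ∎
    where open ≤-Reasoning

triple-colouring-from-hitting : ∀ {N r} (v : Vec (Fin 3) (N * (N * N))) →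
  (∀ S → T (∣ S ∣ ≡ᵇ r) → ∀ c → ∃ λ p → T (isTriple? S (decode₃ p)) × lookup v p ≡ c) →
  Σ (TripleColoring N) λ φ → (S : Subset N) → ∣ S ∣ ≡ r → (c : Fin 3) → HasColour φ S c
triple-colouring-from-hitting {N} {r} v hits = φ , φ-hits
  where
  φ : TripleColoring N
  φ i j k _ _ = lookup v (encode₃ (i , j , k))

  hasColour-at : ∀ S c p → T (isTriple? S (decode₃ p)) → lookup v p ≡ c → HasColour φ S c
  hasColour-at S c p triple vₚ≡c =
    let i<j , j<k , i∈S , j∈S , k∈S = isTriple?-sound S _ _ _ triple
    in _ , _ , _ , i<j , j<k , i∈S , j∈S , k∈S , trans (cong (lookup v) (encode₃-decode₃ {N} p)) vₚ≡c

  φ-hits : (S : Subset N) → ∣ S ∣ ≡ r → (c : Fin 3) → HasColour φ S c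
  φ-hits S ∣S∣≡r c with hits S (≡⇒≡ᵇ ∣ S ∣ r ∣S∣≡r) c
  ... | p , triple , vₚ≡c = hasColour-at S c p triple vₚ≡c

lemma3p1 : (r : ℕ) → r > 3 → (N : ℕ) → IsFloorPow r N →
    Σ (TripleColoring N) λ φ →
      (S : Subset N) → ∣ S ∣ ≡ r → (c : Fin 3) → HasColour φ S c
lemma3p1 r r>3 N (N²⁴≤2^r² , _) =
  uncurry triple-colouring-from-hitting
    (∃-hitting-colouring (λ S → ∣ S ∣ ≡ᵇ r) (λ S → isTriple? S ∘ decode₃) (r C 3)
                         triples≡rC3 few-r-sets)
  where
  triples≡rC3 : ∀ S → T (∣ S ∣ ≡ᵇ r) → ∑[ p < N * (N * N) ] 𝟙 (isTriple? S (decode₃ p)) ≡ r C 3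
  triples≡rC3 S ∣S∣≡r = begin
    ∑[ p < N * (N * N) ] 𝟙 (isTriple? S (decode₃ p)) ≡⟨ sum-decode₃ (𝟙 ∘ isTriple? S) ⟩
    countTriples S                                    ≡⟨ countTriples≡∣S∣C3 S ⟩
    ∣ S ∣ C 3                                         ≡⟨ cong (_C 3) (≡ᵇ⇒≡ ∣ S ∣ r ∣S∣≡r) ⟩
    r C 3                                             ∎
    where open ≡-Reasoning

  few-r-sets : 3 * ∑ˢ N (λ S → 𝟙 (∣ S ∣ ≡ᵇ r)) * 2 ^ (r C 3) < 3 ^ (r C 3)
  few-r-sets = subst (λ b → 3 * b * 2 ^ (r C 3) < 3 ^ (r C 3)) (sym (∑ˢ[∣S∣≡r]≡nCr N r))
                     (3*[NCr]*2^[rC3]<3^[rC3] r N r>3 N²⁴≤2^r²)
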